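{- Let $A$ be a finite alphabet with $|A| = a \geq 2$, let $n$ be a positive integer, and let $p,k$ be integers with $1 \le p \le k \le n$. There does not exist a universal partial word $w$ for $A^n$ that contains a substring of the form $u\diamond^k v$, where $u$ and $v$ are words over $A$ (containing no $\diamond$), $|v| = n-k$, $v$ has period $p$, and $|u| = p$.
   Context: A partial word over $A$ is a finite sequence of characters from $A \cup \{\diamond\}$, where $\diamond \notin A$ is a wild-card symbol; a word (total word) over $A$ is a partial word containing no $\diamond$. $A^n$ denotes the set of words of length $n$ over $A$. For a word $x = x_1\cdots x_n \in A^n$ and a partial word $w = w_1\cdots w_N$, say that the position $i$ (with $0 \le i \le N-n$) covers $x$ if $x_j = w_{i+j}$ for every $1\le j\le n$ with $w_{i+j}\in A$ (i.e. each $\diamond$ may be replaced by any letter). A universal partial word for $A^n$ is a partial word $w$ such that every word in $A^n$ is covered by exactly one position of $w$. A word $v = v_1\cdots v_m$ has period $p$ if $v_i = v_j$ whenever $i \equiv j \pmod p$. $\diamond^k$ denotes $k$ consecutive $\diamond$'s. -}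

module Defs where

open import Data.Nat using (ℕ; zero; suc; _+_; _*_; _≤_; _<_)
open import Data.Sum using (_⊎_)
open import Data.Fin using (Fin; toℕ)
open import Data.Vec using (Vec; lookup; toList)
open import Data.List using (List; []; _∷_; length; map; replicate; _++_)
open import Data.Maybe using (Maybe; just; nothing)
open import Data.Product using (Σ; _×_; _,_)
open import Relation.Binary.PropositionalEquality using (_≡_)

-- A partial word over the alphabet Fin a: `nothing` is the hole symbol ◇,
-- `just c` is the letter c.
PartialWord : ℕ → Set
PartialWord a = List (Maybe (Fin a))

◇ : {a : ℕ} → Maybe (Fin a)
◇ = nothing

total : {a m : ℕ} → Vec (Fin a) m → PartialWord a
total u = map just (toList u)

_!!_ : {X : Set} → List X → ℕ → Maybe X
[] !! _ = nothing
(x ∷ xs) !! zero = just x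
(x ∷ xs) !! suc i = xs !! i

Covers : {a n : ℕ} → PartialWord a → ℕ → Vec (Fin a) n → Set
Covers {a} {n} w i x =
  (i + n ≤ length w) ×
  ((j : Fin n) → (w !! (i + toℕ j) ≡ just ◇) ⊎ (w !! (i + toℕ j) ≡ just (just (lookup x j))))

IsUPWord : (a n : ℕ) → PartialWord a → Set
IsUPWord a n w =
  (x : Vec (Fin a) n) →
    Σ ℕ (λ i → Covers w i x × ((i' : ℕ) → Covers w i' x → i' ≡ i))

-- A word v of length m has period p: v_i = v_j whenever i ≡ j (mod p),
-- i.e. whenever j = i + q·p for some q (the relation is symmetric).
HasPeriod : {a m : ℕ} → Vec (Fin a) m → ℕ → Set
HasPeriod {a} {m} v p =
  (i j : Fin m) → (q : ℕ) → toℕ j ≡ toℕ i + q * p → lookup v i ≡ lookup v j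

ContainsFactor : {a : ℕ} → PartialWord a → PartialWord a → Set
ContainsFactor {a} w f = Σ (PartialWord a) (λ pre → Σ (PartialWord a) (λ post → w ≡ pre ++ f ++ post))

holes : {a : ℕ} → ℕ → PartialWord a
holes k = replicate k ◇

-- Write the factor as f = u ◇^k v, of length p + n. The length-n windows of f at 0 and at p
-- never clash: where both show a letter of v, the letters are p apart in v and agree by
-- periodicity, and everywhere else one of the two shows a hole because p ≤ k. Hence some
-- word of length n is covered at two distinct positions of the universal word.
module Submission where

open import Defs
open import Data.Nat using (ℕ; zero; suc; _+_; _∸_; _≤_; _<_; z≤n; s≤s)
open import Data.Nat.Properties
open import Data.Fin using (Fin; toℕ; fromℕ<)
open import Data.Fin.Properties using (toℕ<n; toℕ-fromℕ<)
open import Data.Vec using (Vec; _∷_; lookup; tabulate; toList)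
open import Data.Vec.Properties using (lookup∘tabulate; length-toList)
open import Data.List using (List; []; _∷_; _++_; length; replicate)
open import Data.List.Properties using (length-map; length-++; length-replicate)
open import Data.Maybe using (Maybe; just; nothing)
open import Data.Product using (Σ; ∃; _×_; _,_; proj₁; proj₂)
open import Data.Sum using (_⊎_; inj₁; inj₂)
open import Function using (_∘_)
open import Relation.Nullary using (¬_)
open import Relation.Binary.PropositionalEquality

!!-++ˡ : {X : Set} (xs ys : List X) {m : ℕ} → m < length xs → (xs ++ ys) !! m ≡ xs !! m
!!-++ˡ (x ∷ xs) ys {zero}  _       = refl
!!-++ˡ (x ∷ xs) ys {suc m} (s≤s h) = !!-++ˡ xs ys h

!!-++ʳ : {X : Set} (xs ys : List X) (m : ℕ) → (xs ++ ys) !! (length xs + m) ≡ ys !! m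
!!-++ʳ []       ys m = refl
!!-++ʳ (x ∷ xs) ys m = !!-++ʳ xs ys m

!!-defined : {X : Set} (xs : List X) {m : ℕ} → m < length xs → ∃ λ x → xs !! m ≡ just x
!!-defined (x ∷ xs) {zero}  _       = x , refl
!!-defined (x ∷ xs) {suc m} (s≤s h) = !!-defined xs h

!!-replicate : {X : Set} (x : X) {k m : ℕ} → m < k → replicate k x !! m ≡ just x
!!-replicate x {suc k} {zero}  _       = refl
!!-replicate x {suc k} {suc m} (s≤s h) = !!-replicate x h

!!-total : {a m : ℕ} (u : Vec (Fin a) m) {r : ℕ} (r<m : r < m) →
  total u !! r ≡ just (just (lookup u (fromℕ< r<m)))
!!-total (c ∷ u) {zero}  _       = refl
!!-total (c ∷ u) {suc r} (s≤s h) = !!-total u h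

length-total : {a m : ℕ} (u : Vec (Fin a) m) → length (total u) ≡ m
length-total u = trans (length-map just (toList u)) (length-toList u)

HasPeriod-step : {a m p : ℕ} (v : Vec (Fin a) m) → HasPeriod v p →
  {r : ℕ} (r<m : r < m) (r+p<m : r + p < m) → lookup v (fromℕ< r<m) ≡ lookup v (fromℕ< r+p<m)
HasPeriod-step {p = p} v periodic r<m r+p<m = periodic (fromℕ< r<m) (fromℕ< r+p<m) 1
  (trans (toℕ-fromℕ< r+p<m) (cong₂ _+_ (sym (toℕ-fromℕ< r<m)) (sym (*-identityˡ p))))

Fits : {a : ℕ} → Maybe (Maybe (Fin a)) → Fin a → Set
Fits s c = s ≡ just ◇ ⊎ s ≡ just (just c)

Fits-transport : {a : ℕ} {s s' : Maybe (Maybe (Fin a))} {c : Fin a} → s' ≡ s → Fits s c → Fits s' c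
Fits-transport e (inj₁ h) = inj₁ (trans e h)
Fits-transport e (inj₂ h) = inj₂ (trans e h)

Covers-++ʳ : {a n : ℕ} (f post : PartialWord a) {i : ℕ} {x : Vec (Fin a) n} →
  Covers f i x → Covers (f ++ post) i x
Covers-++ʳ f post {i} (i+n≤ , fits) =
  ≤-trans i+n≤ (subst (length f ≤_) (sym (length-++ f)) (m≤m+n _ _)) ,
  λ j → Fits-transport (!!-++ˡ f post (<-≤-trans (+-monoʳ-< i (toℕ<n j)) i+n≤)) (fits j)

Covers-++ˡ : {a n : ℕ} (pre f : PartialWord a) {i : ℕ} {x : Vec (Fin a) n} →
  Covers f i x → Covers (pre ++ f) (length pre + i) x
Covers-++ˡ {n = n} pre f {i} (i+n≤ , fits) =
  subst₂ _≤_ (sym (+-assoc (length pre) i n)) (sym (length-++ pre)) (+-monoʳ-≤ (length pre) i+n≤) ,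
  λ j → Fits-transport
    (trans (cong ((pre ++ f) !!_) (+-assoc (length pre) i (toℕ j))) (!!-++ʳ pre f (i + toℕ j)))
    (fits j)

IsUPWord⇒unique-position : {a n : ℕ} (w : PartialWord a) → IsUPWord a n w →
  {x : Vec (Fin a) n} {i i' : ℕ} → Covers w i x → Covers w i' x → i ≡ i'
IsUPWord⇒unique-position w universal {x} c c' with universal x
... | _ , _ , unique = trans (unique _ c) (sym (unique _ c'))

Compatible : {a : ℕ} → PartialWord a → ℕ → ℕ → Set
Compatible f m m' = ∃ λ c → Fits (f !! m) c × Fits (f !! m') c

hole-compatible : {a : ℕ} → Fin a → (f : PartialWord a) {m m' : ℕ} →
  f !! m ≡ just ◇ → m' < length f → Compatible f m m'
hole-compatible d f hole m'< with !!-defined f m'<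
... | nothing , e = d , inj₁ hole , inj₁ e
... | just c  , e = c , inj₁ hole , inj₂ e

compatible-windows⇒common-cover : {a : ℕ} (n : ℕ) (f : PartialWord a) {i i' : ℕ} →
  i + n ≤ length f → i' + n ≤ length f →
  ((j : Fin n) → Compatible f (i + toℕ j) (i' + toℕ j)) →
  ∃ λ (x : Vec (Fin a) n) → Covers f i x × Covers f i' x
compatible-windows⇒common-cover {a} n f {i} {i'} i+n≤ i'+n≤ compatible =
  x , (i+n≤ , proj₁ ∘ fits) , (i'+n≤ , proj₂ ∘ fits)
  where
  x : Vec (Fin a) n
  x = tabulate (proj₁ ∘ compatible)
  fits : (j : Fin n) → Fits (f !! (i + toℕ j)) (lookup x j) × Fits (f !! (i' + toℕ j)) (lookup x j)
  fits j rewrite lookup∘tabulate (proj₁ ∘ compatible) j = proj₂ (compatible j)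

data Offset (b : ℕ) : ℕ → Set where
  below : {r : ℕ} → r < b → Offset b r
  above : (r : ℕ) → Offset b (b + r)

offset : (b r : ℕ) → Offset b r
offset zero    r       = above r
offset (suc b) zero    = below (s≤s z≤n)
offset (suc b) (suc r) with offset b r
... | below r<b = below (s≤s r<b)
... | above r   = above r

module Factor {a p k m : ℕ} (u : Vec (Fin a) p) (v : Vec (Fin a) m) where

  F : PartialWord a
  F = total u ++ holes k ++ total v

  length-F : length F ≡ p + (k + m)
  length-F = begin
    length F                                         ≡⟨ length-++ (total u) ⟩
    length (total u) + length (holes k ++ total v)   ≡⟨ cong₂ _+_ (length-total u) (length-++ (holes k)) ⟩
    p + (length (holes {a} k) + length (total v))    ≡⟨ cong (p +_) (cong₂ _+_ (length-replicate k) (length-total v)) ⟩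
    p + (k + m)                                      ∎
    where open ≡-Reasoning

  F-u : {r : ℕ} (r<p : r < p) → F !! r ≡ just (just (lookup u (fromℕ< r<p)))
  F-u r<p = trans (!!-++ˡ (total u) _ (subst (_ <_) (sym (length-total u)) r<p)) (!!-total u r<p)

  F-after-u : (r : ℕ) → F !! (p + r) ≡ (holes k ++ total v) !! r
  F-after-u r = trans (cong (λ l → F !! (l + r)) (sym (length-total u))) (!!-++ʳ (total u) _ r)

  F-◇ : {r : ℕ} → r < k → F !! (p + r) ≡ just ◇
  F-◇ {r} r<k = begin
    F !! (p + r)                 ≡⟨ F-after-u r ⟩
    (holes k ++ total v) !! r    ≡⟨ !!-++ˡ (holes k) _ (subst (r <_) (sym (length-replicate k)) r<k) ⟩
    holes k !! r                 ≡⟨ !!-replicate ◇ r<k ⟩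
    just ◇                       ∎
    where open ≡-Reasoning

  F-v : {r : ℕ} (r<m : r < m) → F !! (p + (k + r)) ≡ just (just (lookup v (fromℕ< r<m)))
  F-v {r} r<m = begin
    F !! (p + (k + r))                 ≡⟨ F-after-u (k + r) ⟩
    (holes k ++ total v) !! (k + r)    ≡⟨ cong (λ l → (holes k ++ total v) !! (l + r)) (sym (length-replicate k)) ⟩
    (holes k ++ total v) !! (length (holes {a} k) + r)   ≡⟨ !!-++ʳ (holes k) _ r ⟩
    total v !! r                       ≡⟨ !!-total v r<m ⟩
    just (just (lookup v (fromℕ< r<m))) ∎
    where open ≡-Reasoning

  -- Where both windows show a letter of v, the one at p is p places further along v, which
  -- the period absorbs; at every other position one window shows a hole, since p ≤ k.
  windows-compatible : Fin a → HasPeriod v p → p ≤ k →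
    {j : ℕ} → j < k + m → Compatible F j (p + j)
  windows-compatible d periodic p≤k {j} j< with offset p j
  ... | below j<p = lookup u (fromℕ< j<p) , inj₂ (F-u j<p) , inj₁ (F-◇ (<-≤-trans j<p p≤k))
  ... | above r with offset k r
  ...   | below r<k = hole-compatible d F (F-◇ r<k) (subst (_ <_) (sym length-F) (+-monoʳ-< p j<))
  ...   | above s = lookup v (fromℕ< s<m) , inj₂ (F-v s<m) ,
                    inj₂ (trans (cong (F !!_) (cong (p +_) shift)) (trans (F-v s+p<m)
                      (cong (just ∘ just) (sym (HasPeriod-step v periodic s<m s+p<m)))))
    where
    shift : p + (k + s) ≡ k + (s + p)
    shift = trans (+-comm p (k + s)) (+-assoc k s p)
    s+p<m : s + p < m
    s+p<m = +-cancelˡ-< k _ _ (subst (_< k + m) shift j<)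
    s<m : s < m
    s<m = ≤-<-trans (m≤m+n s p) s+p<m

  self-overlap : Fin a → HasPeriod v p → p ≤ k →
    ∃ λ (x : Vec (Fin a) (k + m)) → Covers F 0 x × Covers F p x
  self-overlap d periodic p≤k =
    compatible-windows⇒common-cover (k + m) F
      (subst (_ ≤_) (sym length-F) (m≤n+m (k + m) p))
      (subst (_ ≤_) (sym length-F) ≤-refl)
      (λ j → windows-compatible d periodic p≤k (toℕ<n j))

lemma3p1 : (a n p k : ℕ) → 2 ≤ a → 1 ≤ n → 1 ≤ p → p ≤ k → k ≤ n →
    ¬ (Σ (PartialWord a) λ w → IsUPWord a n w ×
         Σ (Vec (Fin a) p) λ u → Σ (Vec (Fin a) (n ∸ k)) λ v →
           HasPeriod v p × ContainsFactor w (total u ++ holes k ++ total v))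
lemma3p1 a n p k 2≤a _ 1≤p p≤k k≤n (w , universal , u , v , periodic , pre , post , w≡) =
  >⇒≢ 1≤p (+-cancelˡ-≡ (length pre) p 0 (sym same-position))
  where
  open Factor {k = k} u v
  letter : Fin a
  letter = fromℕ< (≤-trans (s≤s z≤n) 2≤a)
  common-word : ∃ λ (x : Vec (Fin a) n) → Covers F 0 x × Covers F p x
  common-word = subst (λ l → ∃ λ (x : Vec (Fin a) l) → Covers F 0 x × Covers F p x)
                  (m+[n∸m]≡n k≤n) (self-overlap letter periodic p≤k)
  x : Vec (Fin a) n
  x = proj₁ common-word
  in-w : {i : ℕ} → Covers F i x → Covers w (length pre + i) x
  in-w {i} c = subst (λ w′ → Covers w′ (length pre + i) x) (sym w≡)
                     (Covers-++ˡ pre (F ++ post) {x = x} (Covers-++ʳ F post {x = x} c))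
  same-position : length pre + 0 ≡ length pre + p
  same-position = IsUPWord⇒unique-position w universal {x = x}
                    (in-w (proj₁ (proj₂ common-word))) (in-w (proj₂ (proj₂ common-word)))
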